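{- Let $j^{\operatorname{last}}_{m,k}(213)$ be the number of $213$-avoiding Jacobi permutations $\pi\in\mathfrak{S}_m$ whose last letter equals $k$. For all $n\geq k\geq1$, \[ j^{\operatorname{last}}_{2n,k}(213)=\frac{2k}{3n-k}\binom{3n-k}{2n}\qquad\text{and}\qquad j^{\operatorname{last}}_{2n-1,k}(213)=\frac{2k-1}{3n-k-1}\binom{3n-k-1}{2n-1}. \]
   Context: A permutation of a finite set $S$ of positive integers is a word in which each element of $S$ appears exactly once; $\mathfrak{S}_m$ is the set of permutations of $\{1,\dots,m\}$. For a permutation $\pi$ and a letter $x$ of $\pi$, $\rho_\pi(x)$ is the maximal consecutive subword of $\pi$ consisting of the letters immediately to the right of $x$ that are all larger than $x$. $\pi$ is Jacobi if $|\rho_\pi(x)|$ is even for all letters $x$. A permutation $\pi$ avoids a pattern $\sigma$ if no subword of $\pi$ has standardization (relative order) $\sigma$. -}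

module Defs where

open import Data.Nat using (ℕ; suc; _<_; _<?_)
open import Data.Nat.Divisibility using (_∣_)
open import Data.List using (List; []; _∷_; length; takeWhile; applyUpTo; _∷ʳ_)
open import Data.List.Relation.Binary.Permutation.Propositional using (_↭_)
open import Data.List.Relation.Binary.Sublist.Propositional using (_⊆_)
open import Data.List.Relation.Unary.Unique.Propositional using (Unique)
open import Data.List.Membership.Propositional using (_∈_)
open import Data.Product using (Σ; ∃; ∃-syntax; _×_)
open import Data.Unit using (⊤)
open import Function.Bundles using (_⇔_)
open import Relation.Nullary using (¬_)
open import Relation.Binary.PropositionalEquality using (_≡_)

[1‥_] : ℕ → List ℕ
[1‥ m ] = applyUpTo suc m

IsPerm : ℕ → List ℕ → Set
IsPerm m π = π ↭ [1‥ m ]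

ρlen : ℕ → List ℕ → ℕ
ρlen x rest = length (takeWhile (x <?_) rest)

Jacobi : List ℕ → Set
Jacobi []         = ⊤
Jacobi (x ∷ rest) = (2 ∣ ρlen x rest) × Jacobi rest

Avoids213 : List ℕ → Set
Avoids213 π = ¬ (∃[ a ] ∃[ b ] ∃[ c ] ((a ∷ b ∷ c ∷ []) ⊆ π × b < a × a < c))

LastIs : ℕ → List ℕ → Set
LastIs k π = ∃[ σ ] π ≡ σ ∷ʳ k

JLast213 : ℕ → ℕ → List ℕ → Set
JLast213 m k π = IsPerm m π × Avoids213 π × Jacobi π × LastIs k π

-- "the number of words π satisfying P is N": there is a duplicate-free list
-- enumerating exactly the words satisfying P, of length N
HasCount : (List ℕ → Set) → ℕ → Set
HasCount P N = Σ (List (List ℕ)) λ L → Unique L × (∀ π → (π ∈ L ⇔ P π)) × length L ≡ N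

-- A 213-avoiding permutation of lo, lo+1, …, lo+n-1 factors as u lo v with every letter of u
-- above every letter of v, so these permutations are the images of binary trees under
-- encodeFrom lo: the root is the minimum, and the right subtree is the block just above it,
-- written after it.  As ρ(lo) is all of v, the Jacobi condition says that every right subtree
-- has an even number of nodes, and the last letter is the length of the right spine.  Such a
-- tree with an even number of nodes is bin (bin a b) c for three smaller ones, i.e. a ternary
-- tree; reading the left subtrees along the right spine two at a time (one alone at the top
-- when the size is odd) turns a tree of size 2p + r and spine ⌈r/2⌉ into a forest of r ternary
-- trees with p nodes in total.  Splitting on whether the first tree is a leaf, these forests
-- satisfy B(p+1, r+1) = B(p+1, r) + B(p, r+3), which is solved by the Fuss–Catalan numbers
-- B(p, r) = r/(3p+r) · C(3p+r, 2p+r); p = n - k and r = 2k or 2k - 1 give the formulas.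

{-# OPTIONS --safe #-}
module Submission where

open import Defs
open import Data.Nat using (ℕ; zero; suc; _+_; _*_; _∸_; _/_; _!; _<_; _≤_; _<?_; s≤s; z<s)
open import Data.Nat.Properties
open import Data.Nat.Combinatorics using (_C_; nCk≡n!/k![n-k]!; k![n∸k]!∣n!)
open import Data.Nat.DivMod using (m/n*n≡m)
open import Data.Nat.Divisibility using (_∣_; ∣m+n∣m⇒∣n; ∣m∣n⇒∣m+n; ∣1⇒≡1; ∣-refl; m∣m*n)
open import Data.Nat.Induction using (<-wellFounded)
open import Data.Nat.Tactic.RingSolver using (solve-∀)
open import Data.List using (List; []; _∷_; [_]; _++_; _∷ʳ_; map; length; applyUpTo; takeWhile)
open import Data.List.Properties
  using (length-++; length-map; ++-assoc; ++-identityʳ; ++-conicalʳ; ∷ʳ-injective; ∷-injectiveˡ; ∷-injectiveʳ)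
open import Data.List.Membership.Propositional using (_∈_; _∉_)
open import Data.List.Membership.Propositional.Properties
  using (∈-map⁺; ∈-map⁻; ∈-++⁺ˡ; ∈-++⁺ʳ; ∈-++⁻; ∈-∃++)
open import Data.List.Relation.Unary.Any using (here; there)
open import Data.List.Relation.Unary.All using (All; []; _∷_)
import Data.List.Relation.Unary.All as All
import Data.List.Relation.Unary.All.Properties as All
open import Data.List.Relation.Unary.All.Properties using (all⇒takeWhile≗id)
open import Data.List.Relation.Unary.AllPairs using ([]; _∷_)
open import Data.List.Relation.Unary.Unique.Propositional using (Unique)
import Data.List.Relation.Unary.Unique.Propositional.Properties as Unique
open import Data.List.Relation.Binary.Sublist.Propositional using (_⊆_; []; _∷_; ⊆-refl; ⊆-trans; to∈; from∈)
import Data.List.Relation.Binary.Sublist.Propositional as Sublist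
import Data.List.Relation.Binary.Sublist.Propositional.Properties as Sublist
open import Data.List.Relation.Binary.Sublist.Propositional.Properties using (∷ˡ⁻)
open import Data.List.Relation.Binary.Permutation.Propositional
  using (_↭_; ↭-refl; ↭-sym; ↭-trans; ↭-prep; ↭⇒↭ₛ; module PermutationReasoning)
import Data.List.Relation.Binary.Permutation.Propositional.Properties as ↭
import Data.List.Relation.Binary.Permutation.Setoid.Properties as ↭ₛ
open import Data.Vec using (Vec; []; _∷_; replicate; sum) renaming (map to mapᵥ)
import Data.Vec.Properties as Vec
open import Data.Product using (∃-syntax; ∃₂; _×_; _,_; proj₁; proj₂)
open import Data.Sum using (inj₁; inj₂)
open import Data.Empty using (⊥-elim)
open import Data.Unit using (tt)
open import Function using (_∘_; case_of_)
open import Function.Bundles using (_⇔_; mk⇔; module Equivalence)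
open import Induction.WellFounded using (Acc; acc)
open import Relation.Nullary using (¬_; yes; no)
open import Relation.Nullary.Decidable using (dec-true; dec-false)
open import Relation.Binary.Definitions using (tri<; tri≈; tri>)
open import Relation.Binary.PropositionalEquality hiding ([_])

-- Forests of ternary trees

data Ternary : Set where
  leaf : Ternary
  node : Ternary → Ternary → Ternary → Ternary

nodes : Ternary → ℕ
nodes leaf         = 0
nodes (node a b c) = suc (nodes a + nodes b + nodes c)

forestNodes : ∀ {r} → Vec Ternary r → ℕ
forestNodes F = sum (mapᵥ nodes F)

graft : ∀ {r} → Vec Ternary (3 + r) → Vec Ternary (suc r)
graft (a ∷ b ∷ c ∷ F) = node a b c ∷ F

forests : ℕ → (r : ℕ) → List (Vec Ternary r)
forests zero    r       = [ replicate r leaf ]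
forests (suc p) zero    = []
forests (suc p) (suc r) = map (leaf ∷_) (forests (suc p) r) ++ map graft (forests p (3 + r))

forestCount : ℕ → ℕ → ℕ
forestCount zero    r       = 1
forestCount (suc p) zero    = 0
forestCount (suc p) (suc r) = forestCount (suc p) r + forestCount p (3 + r)

length-forests : ∀ p r → length (forests p r) ≡ forestCount p r
length-forests zero    r       = refl
length-forests (suc p) zero    = refl
length-forests (suc p) (suc r) = begin
  length (map (leaf ∷_) (forests (suc p) r) ++ map graft (forests p (3 + r)))
    ≡⟨ length-++ (map (leaf ∷_) (forests (suc p) r)) ⟩
  length (map (leaf ∷_) (forests (suc p) r)) + length (map graft (forests p (3 + r)))
    ≡⟨ cong₂ _+_ (length-map _ (forests (suc p) r)) (length-map graft (forests p (3 + r))) ⟩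
  length (forests (suc p) r) + length (forests p (3 + r))
    ≡⟨ cong₂ _+_ (length-forests (suc p) r) (length-forests p (3 + r)) ⟩
  forestCount (suc p) r + forestCount p (3 + r) ∎
  where open ≡-Reasoning

forestNodes-graft : ∀ {r} (F : Vec Ternary (3 + r)) → forestNodes (graft F) ≡ suc (forestNodes F)
forestNodes-graft (a ∷ b ∷ c ∷ F) =
  cong suc (trans (+-assoc (nodes a + nodes b) (nodes c) _) (+-assoc (nodes a) (nodes b) _))

forestNodes≡0 : ∀ {r} (F : Vec Ternary r) → forestNodes F ≡ 0 → F ≡ replicate r leaf
forestNodes≡0 []           _  = refl
forestNodes≡0 (leaf ∷ F)   eq = cong (leaf ∷_) (forestNodes≡0 F eq)

forestNodes-replicate : ∀ r → forestNodes (replicate r leaf) ≡ 0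
forestNodes-replicate zero    = refl
forestNodes-replicate (suc r) = forestNodes-replicate r

forests-sound : ∀ p r → All (λ F → forestNodes F ≡ p) (forests p r)
forests-sound zero    r       = forestNodes-replicate r ∷ []
forests-sound (suc p) zero    = []
forests-sound (suc p) (suc r) =
  All.++⁺ (All.map⁺ (forests-sound (suc p) r))
          (All.map⁺ (All.map (λ {G} eq → trans (forestNodes-graft G) (cong suc eq)) (forests-sound p (3 + r))))

forests-complete : ∀ p r (F : Vec Ternary r) → forestNodes F ≡ p → F ∈ forests p r
forests-complete zero    r       F                  eq = here (forestNodes≡0 F eq)
forests-complete (suc p) (suc r) (leaf ∷ F)         eq =
  ∈-++⁺ˡ (∈-map⁺ (leaf ∷_) (forests-complete (suc p) r F eq))
forests-complete (suc p) (suc r) (node a b c ∷ F)   eq =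
  ∈-++⁺ʳ (map (leaf ∷_) (forests (suc p) r))
    (∈-map⁺ graft (forests-complete p (3 + r) (a ∷ b ∷ c ∷ F)
      (suc-injective (trans (sym (forestNodes-graft (a ∷ b ∷ c ∷ F))) eq))))

graft-injective : ∀ {r} {F G : Vec Ternary (3 + r)} → graft F ≡ graft G → F ≡ G
graft-injective {F = _ ∷ _ ∷ _ ∷ _} {G = _ ∷ _ ∷ _ ∷ _} refl = refl

forests-unique : ∀ p r → Unique (forests p r)
forests-unique zero    r       = [] ∷ []
forests-unique (suc p) zero    = []
forests-unique (suc p) (suc r) =
  Unique.++⁺ (Unique.map⁺ Vec.∷-injectiveʳ (forests-unique (suc p) r))
             (Unique.map⁺ graft-injective (forests-unique p (3 + r)))
             leaf-vs-node
  where
  leaf-vs-node : ∀ {F} → ¬ (F ∈ map (leaf ∷_) (forests (suc p) r) × F ∈ map graft (forests p (3 + r)))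
  leaf-vs-node (F∈ˡ , F∈ʳ) with ∈-map⁻ (leaf ∷_) F∈ˡ | ∈-map⁻ graft F∈ʳ
  ... | _ , _ , refl | (_ ∷ _ ∷ _ ∷ _) , _ , ()

-- The Fuss–Catalan closed form

x*[y*z]≡y*[x*z] : ∀ x y z → x * (y * z) ≡ y * (x * z)
x*[y*z]≡y*[x*z] = solve-∀

!-unfold : ∀ {m n} → m ≡ suc n → m ! ≡ m * n !
!-unfold refl = refl

C-factorial : ∀ k m → ((k + m) C k) * (k ! * m !) ≡ (k + m) !
C-factorial k m = begin
  ((k + m) C k) * (k ! * m !)             ≡⟨ cong (λ j → ((k + m) C k) * (k ! * j !)) (sym (m+n∸m≡n k m)) ⟩
  ((k + m) C k) * (k ! * (k + m ∸ k) !)   ≡⟨ cong (_* (k ! * (k + m ∸ k) !)) (nCk≡n!/k![n-k]! k≤k+m) ⟩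
  (k + m) ! / (k ! * (k + m ∸ k) !) * (k ! * (k + m ∸ k) !) ≡⟨ m/n*n≡m (k![n∸k]!∣n! k≤k+m) ⟩
  (k + m) ! ∎
  where
  open ≡-Reasoning
  k≤k+m = m≤m+n k m
  instance _ = k !* (k + m ∸ k) !≢0

denominator : ℕ → ℕ → ℕ
denominator p r = (2 * p + r) ! * p !

denominator-sucʳ : ∀ p r → denominator p (suc r) ≡ (2 * p + suc r) * denominator p r
denominator-sucʳ p r = begin
  (2 * p + suc r) ! * p !                 ≡⟨ cong (_* p !) (!-unfold (+-suc (2 * p) r)) ⟩
  (2 * p + suc r) * (2 * p + r) ! * p !   ≡⟨ *-assoc (2 * p + suc r) _ _ ⟩
  (2 * p + suc r) * denominator p r       ∎
  where open ≡-Reasoning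

denominator-sucˡ : ∀ p r → denominator (suc p) r ≡ suc p * denominator p (2 + r)
denominator-sucˡ p r = begin
  (2 * suc p + r) ! * (suc p * p !)       ≡⟨ cong (λ j → j ! * (suc p * p !)) (two-suc p r) ⟩
  (2 * p + (2 + r)) ! * (suc p * p !)     ≡⟨ x*[y*z]≡y*[x*z] ((2 * p + (2 + r)) !) (suc p) (p !) ⟩
  suc p * denominator p (2 + r)           ∎
  where
  open ≡-Reasoning
  two-suc : ∀ p r → 2 * suc p + r ≡ 2 * p + (2 + r)
  two-suc = solve-∀

binomial-denominator : ∀ p r → ((3 * p + r) C (2 * p + r)) * denominator p r ≡ (3 * p + r) !
binomial-denominator p r = subst (λ n → (n C (2 * p + r)) * denominator p r ≡ n !)
                                 (three-times p r) (C-factorial (2 * p + r) p)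
  where
  three-times : ∀ p r → 2 * p + r + p ≡ 3 * p + r
  three-times = solve-∀

forestCount-factorial : ∀ p s → forestCount p (suc s) * denominator p (suc s) ≡ suc s * (3 * p + s) !
forestCount-factorial zero    s       = trans (*-identityˡ _) (*-identityʳ _)
forestCount-factorial (suc p) zero    = begin
  forestCount p 3 * denominator (suc p) 1      ≡⟨ cong (forestCount p 3 *_) (denominator-sucˡ p 1) ⟩
  forestCount p 3 * (suc p * denominator p 3)  ≡⟨ x*[y*z]≡y*[x*z] (forestCount p 3) (suc p) _ ⟩
  suc p * (forestCount p 3 * denominator p 3)  ≡⟨ cong (suc p *_) (forestCount-factorial p 2) ⟩
  suc p * (3 * (3 * p + 2) !)                  ≡⟨ arith p ((3 * p + 2) !) ⟩
  suc (3 * p + 2) !                            ≡⟨ cong _! (arith′ p) ⟩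
  (3 * suc p + 0) !                            ≡⟨ *-identityˡ _ ⟨
  1 * (3 * suc p + 0) !                        ∎
  where
  open ≡-Reasoning
  arith : ∀ p x → suc p * (3 * x) ≡ suc (3 * p + 2) * x
  arith = solve-∀
  arith′ : ∀ p → suc (3 * p + 2) ≡ 3 * suc p + 0
  arith′ = solve-∀
forestCount-factorial (suc p) (suc t) = begin
  (B₁ + B₂) * denominator (suc p) (2 + t)
    ≡⟨ *-distribʳ-+ (denominator (suc p) (2 + t)) B₁ B₂ ⟩
  B₁ * denominator (suc p) (2 + t) + B₂ * denominator (suc p) (2 + t)
    ≡⟨ cong₂ _+_ (cong (B₁ *_) (denominator-sucʳ (suc p) (suc t)))
                 (cong (B₂ *_) (denominator-sucˡ p (2 + t))) ⟩
  B₁ * (a * denominator (suc p) (suc t)) + B₂ * (suc p * denominator p (4 + t))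
    ≡⟨ cong₂ _+_ (x*[y*z]≡y*[x*z] B₁ a _) (x*[y*z]≡y*[x*z] B₂ (suc p) _) ⟩
  a * (B₁ * denominator (suc p) (suc t)) + suc p * (B₂ * denominator p (4 + t))
    ≡⟨ cong₂ (λ x y → a * x + suc p * y) (forestCount-factorial (suc p) t) (forestCount-factorial p (3 + t)) ⟩
  a * (suc t * (3 * suc p + t) !) + suc p * ((4 + t) * (3 * p + (3 + t)) !)
    ≡⟨ cong (λ n → a * (suc t * (3 * suc p + t) !) + suc p * ((4 + t) * n !)) (shift p t) ⟩
  a * (suc t * (3 * suc p + t) !) + suc p * ((4 + t) * (3 * suc p + t) !)
    ≡⟨ recurrence p t ((3 * suc p + t) !) ⟩
  (2 + t) * ((3 * suc p + suc t) * (3 * suc p + t) !)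
    ≡⟨ cong ((2 + t) *_) (!-unfold (+-suc (3 * suc p) t)) ⟨
  (2 + t) * (3 * suc p + suc t) ! ∎
  where
  open ≡-Reasoning
  B₁ = forestCount (suc p) (suc t)
  B₂ = forestCount p (4 + t)
  a = 2 * suc p + (2 + t)
  shift : ∀ p t → 3 * p + (3 + t) ≡ 3 * suc p + t
  shift = solve-∀
  recurrence : ∀ p t x → (2 * suc p + (2 + t)) * (suc t * x) + suc p * ((4 + t) * x)
                         ≡ (2 + t) * ((3 * suc p + suc t) * x)
  recurrence = solve-∀

forestCount-closed : ∀ p r → (3 * p + r) * forestCount p r ≡ r * ((3 * p + r) C (2 * p + r))
forestCount-closed zero    zero    = refl
forestCount-closed (suc p) zero    = *-zeroʳ (3 * suc p + 0)
forestCount-closed p       (suc s) = *-cancelʳ-≡ _ _ (denominator p (suc s)) {{(2 * p + suc s) !* p !≢0}} (begin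
  n * forestCount p (suc s) * denominator p (suc s)   ≡⟨ *-assoc n _ _ ⟩
  n * (forestCount p (suc s) * denominator p (suc s)) ≡⟨ cong (n *_) (forestCount-factorial p s) ⟩
  n * (suc s * (3 * p + s) !)                         ≡⟨ x*[y*z]≡y*[x*z] n (suc s) _ ⟩
  suc s * (n * (3 * p + s) !)                         ≡⟨ cong (suc s *_) (!-unfold (+-suc (3 * p) s)) ⟨
  suc s * n !                                         ≡⟨ cong (suc s *_) (binomial-denominator p (suc s)) ⟨
  suc s * ((n C (2 * p + suc s)) * denominator p (suc s)) ≡⟨ *-assoc (suc s) (n C (2 * p + suc s)) _ ⟨
  suc s * (n C (2 * p + suc s)) * denominator p (suc s) ∎)
  where
  open ≡-Reasoning
  n = 3 * p + suc s

-- Binary trees whose right subtrees have even size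

∣m+n∣n⇒∣m : ∀ {d m n} → d ∣ m + n → d ∣ n → d ∣ m
∣m+n∣n⇒∣m {d} {m} {n} d∣m+n = ∣m+n∣m⇒∣n (subst (d ∣_) (+-comm m n) d∣m+n)

2∣n⇒2∤1+n : ∀ {n} → 2 ∣ n → ¬ 2 ∣ suc n
2∣n⇒2∤1+n 2∣n 2∣1+n = case ∣1⇒≡1 (∣m+n∣n⇒∣m {m = 1} 2∣1+n 2∣n) of λ ()

2∣2+n⇒2∣n : ∀ {n} → 2 ∣ 2 + n → 2 ∣ n
2∣2+n⇒2∣n 2∣2+n = ∣m+n∣m⇒∣n 2∣2+n ∣-refl

data Tree : Set where
  tip : Tree
  bin : Tree → Tree → Tree

size : Tree → ℕ
size tip       = 0
size (bin l r) = suc (size l + size r)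

rightSpine : Tree → ℕ
rightSpine tip       = 0
rightSpine (bin l r) = suc (rightSpine r)

data EvenRight : Tree → Set where
  tip : EvenRight tip
  bin : ∀ {l r} → EvenRight l → EvenRight r → 2 ∣ size r → EvenRight (bin l r)

toTree : Ternary → Tree
toTree leaf         = tip
toTree (node a b c) = bin (bin (toTree a) (toTree b)) (toTree c)

fromTree : Tree → Ternary
fromTree (bin (bin a b) c) = node (fromTree a) (fromTree b) (fromTree c)
fromTree _                 = leaf

size-toTree : ∀ t → size (toTree t) ≡ 2 * nodes t
size-toTree leaf         = refl
size-toTree (node a b c) rewrite size-toTree a | size-toTree b | size-toTree c = arith (nodes a) (nodes b) (nodes c)
  where
  arith : ∀ a b c → suc (suc (2 * a + 2 * b) + 2 * c) ≡ 2 * suc (a + b + c)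
  arith = solve-∀

2∣size-toTree : ∀ t → 2 ∣ size (toTree t)
2∣size-toTree t = subst (2 ∣_) (sym (size-toTree t)) (m∣m*n (nodes t))

toTree-evenRight : ∀ t → EvenRight (toTree t)
toTree-evenRight leaf         = tip
toTree-evenRight (node a b c) =
  bin (bin (toTree-evenRight a) (toTree-evenRight b) (2∣size-toTree b)) (toTree-evenRight c) (2∣size-toTree c)

left right : Tree → Tree
left (bin l _) = l
left tip       = tip
right (bin _ r) = r
right tip       = tip

toTree-injective : ∀ {s t} → toTree s ≡ toTree t → s ≡ t
toTree-injective {leaf}       {leaf}          _  = refl
toTree-injective {node a b c} {node a′ b′ c′} eq
  with refl ← toTree-injective {a} {a′} (cong (left ∘ left) eq)
     | refl ← toTree-injective {b} {b′} (cong (right ∘ left) eq)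
     | refl ← toTree-injective {c} {c′} (cong right eq) = refl

2∣size-leftmost : ∀ {a b c} → EvenRight (bin (bin a b) c) → 2 ∣ size (bin (bin a b) c) → 2 ∣ size a
2∣size-leftmost (bin (bin _ _ 2∣b) _ 2∣c) 2∣x =
  ∣m+n∣n⇒∣m (∣m+n∣n⇒∣m (2∣2+n⇒2∣n 2∣x) 2∣c) 2∣b

toTree-fromTree : ∀ {x} → EvenRight x → 2 ∣ size x → toTree (fromTree x) ≡ x
toTree-fromTree tip _ = refl
toTree-fromTree (bin {tip} _ _ 2∣r) 2∣x = ⊥-elim (2∣n⇒2∤1+n 2∣r 2∣x)
toTree-fromTree e@(bin {bin _ _} (bin ea eb 2∣b) ec 2∣c) 2∣x =
  cong₂ bin (cong₂ bin (toTree-fromTree ea (2∣size-leftmost e 2∣x)) (toTree-fromTree eb 2∣b))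
            (toTree-fromTree ec 2∣c)

-- Vectors of length double k, unlike 2 * k, can be matched two entries at a time.
double : ℕ → ℕ
double zero    = zero
double (suc k) = suc (suc (double k))

evenSpine : ∀ {k} → Vec Ternary (double k) → Tree
evenSpine {zero}  []          = tip
evenSpine {suc k} (a ∷ b ∷ F) = bin (bin (toTree a) (toTree b)) (evenSpine F)

oddSpine : ∀ {k} → Vec Ternary (suc (double k)) → Tree
oddSpine (a ∷ F) = bin (toTree a) (evenSpine F)

size-evenSpine : ∀ {k} (F : Vec Ternary (double k)) → size (evenSpine F) ≡ 2 * (k + forestNodes F)
size-evenSpine {zero}  []          = refl
size-evenSpine {suc k} (a ∷ b ∷ F) rewrite size-toTree a | size-toTree b | size-evenSpine F =
  arith (nodes a) (nodes b) (forestNodes F) k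
  where
  arith : ∀ a b n k → suc (suc (2 * a + 2 * b) + 2 * (k + n)) ≡ 2 * (suc k + (a + (b + n)))
  arith = solve-∀

size-oddSpine : ∀ {k} (F : Vec Ternary (suc (double k))) → size (oddSpine F) ≡ suc (2 * (k + forestNodes F))
size-oddSpine {k} (a ∷ F) rewrite size-toTree a | size-evenSpine F = cong suc (arith (nodes a) (forestNodes F) k)
  where
  arith : ∀ a n k → 2 * a + 2 * (k + n) ≡ 2 * (k + (a + n))
  arith = solve-∀

2∣size-evenSpine : ∀ {k} (F : Vec Ternary (double k)) → 2 ∣ size (evenSpine F)
2∣size-evenSpine {k} F = subst (2 ∣_) (sym (size-evenSpine F)) (m∣m*n (k + forestNodes F))

evenRight-evenSpine : ∀ {k} (F : Vec Ternary (double k)) → EvenRight (evenSpine F)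
evenRight-evenSpine {zero}  []          = tip
evenRight-evenSpine {suc k} (a ∷ b ∷ F) =
  bin (bin (toTree-evenRight a) (toTree-evenRight b) (2∣size-toTree b)) (evenRight-evenSpine F) (2∣size-evenSpine F)

evenRight-oddSpine : ∀ {k} (F : Vec Ternary (suc (double k))) → EvenRight (oddSpine F)
evenRight-oddSpine (a ∷ F) = bin (toTree-evenRight a) (evenRight-evenSpine F) (2∣size-evenSpine F)

rightSpine-evenSpine : ∀ {k} (F : Vec Ternary (double k)) → rightSpine (evenSpine F) ≡ k
rightSpine-evenSpine {zero}  []          = refl
rightSpine-evenSpine {suc k} (a ∷ b ∷ F) = cong suc (rightSpine-evenSpine F)

rightSpine-oddSpine : ∀ {k} (F : Vec Ternary (suc (double k))) → rightSpine (oddSpine F) ≡ suc k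
rightSpine-oddSpine (a ∷ F) = cong suc (rightSpine-evenSpine F)

evenSpine-injective : ∀ {k} {F G : Vec Ternary (double k)} → evenSpine F ≡ evenSpine G → F ≡ G
evenSpine-injective {zero}  {[]}        {[]}          _  = refl
evenSpine-injective {suc k} {a ∷ b ∷ F} {a′ ∷ b′ ∷ G} eq
  with refl ← toTree-injective {a} {a′} (cong (left ∘ left) eq)
     | refl ← toTree-injective {b} {b′} (cong (right ∘ left) eq)
     | refl ← evenSpine-injective {k} {F} {G} (cong right eq) = refl

oddSpine-injective : ∀ {k} {F G : Vec Ternary (suc (double k))} → oddSpine F ≡ oddSpine G → F ≡ G
oddSpine-injective {k} {a ∷ F} {a′ ∷ G} eq
  with refl ← toTree-injective {a} {a′} (cong left eq)
     | refl ← evenSpine-injective {k} {F} {G} (cong right eq) = refl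

evenSpine-surjective : ∀ {k x} → EvenRight x → 2 ∣ size x → rightSpine x ≡ k → ∃[ F ] evenSpine {k} F ≡ x
evenSpine-surjective {zero} tip _ _ = [] , refl
evenSpine-surjective (bin {tip} _ _ 2∣r) 2∣x _ = ⊥-elim (2∣n⇒2∤1+n 2∣r 2∣x)
evenSpine-surjective {suc k} e@(bin {bin a b} (bin ea eb 2∣b) ec 2∣c) 2∣x spine≡
  with F , refl ← evenSpine-surjective {k} ec 2∣c (suc-injective spine≡) =
  fromTree a ∷ fromTree b ∷ F ,
  cong₂ bin (cong₂ bin (toTree-fromTree ea (2∣size-leftmost e 2∣x)) (toTree-fromTree eb 2∣b)) refl

oddSpine-surjective : ∀ {k x} → EvenRight x → 2 ∣ suc (size x) → rightSpine x ≡ suc k →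
                      ∃[ F ] oddSpine {k} F ≡ x
oddSpine-surjective {k} (bin {a} ea ec 2∣c) 2∣1+x spine≡
  with F , refl ← evenSpine-surjective {k} ec 2∣c (suc-injective spine≡) =
  fromTree a ∷ F ,
  cong (λ t → bin t (evenSpine F)) (toTree-fromTree ea (∣m+n∣n⇒∣m (2∣2+n⇒2∣n 2∣1+x) 2∣c))

-- 213-avoiding Jacobi permutations as binary trees

interval : ℕ → ℕ → List ℕ
interval lo zero    = []
interval lo (suc n) = lo ∷ interval (suc lo) n

applyUpTo≡interval : ∀ n lo (f : ℕ → ℕ) → (∀ i → f i ≡ lo + i) → applyUpTo f n ≡ interval lo n
applyUpTo≡interval zero    lo f f≗ = refl
applyUpTo≡interval (suc n) lo f f≗ = cong₂ _∷_ (trans (f≗ 0) (+-identityʳ lo))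
  (applyUpTo≡interval n (suc lo) (f ∘ suc) (λ i → trans (f≗ (suc i)) (+-suc lo i)))

[1‥]≡interval : ∀ m → [1‥ m ] ≡ interval 1 m
[1‥]≡interval m = applyUpTo≡interval m 1 suc (λ _ → refl)

length-interval : ∀ lo n → length (interval lo n) ≡ n
length-interval lo zero    = refl
length-interval lo (suc n) = cong suc (length-interval (suc lo) n)

interval-++ : ∀ lo m n → interval lo (m + n) ≡ interval lo m ++ interval (lo + m) n
interval-++ lo zero    n = cong (λ l → interval l n) (sym (+-identityʳ lo))
interval-++ lo (suc m) n = cong (lo ∷_) (trans (interval-++ (suc lo) m n)
                                               (cong (λ l → interval (suc lo) m ++ interval l n) (sym (+-suc lo m))))

∈-interval⁻ : ∀ {x} lo n → x ∈ interval lo n → lo ≤ x × x < lo + n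
∈-interval⁻ lo (suc n) (here refl) = ≤-refl , m<m+n lo z<s
∈-interval⁻ {x} lo (suc n) (there x∈) with lo<x , x<lo+n ← ∈-interval⁻ (suc lo) n x∈ =
  <⇒≤ lo<x , subst (x <_) (sym (+-suc lo n)) x<lo+n

interval-unique : ∀ lo n → Unique (interval lo n)
interval-unique lo zero    = []
interval-unique lo (suc n) =
  All.tabulate (λ x∈ lo≡x → <⇒≢ (proj₁ (∈-interval⁻ (suc lo) n x∈)) lo≡x) ∷ interval-unique (suc lo) n

Unique-resp-↭ : ∀ {xs ys : List ℕ} → xs ↭ ys → Unique xs → Unique ys
Unique-resp-↭ p = ↭ₛ.Unique-resp-↭ (setoid ℕ) (↭⇒↭ₛ p)

Unique-++⇒disjoint : ∀ {x} (xs : List ℕ) {ys} → Unique (xs ++ ys) → x ∈ xs → x ∉ ys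
Unique-++⇒disjoint (_ ∷ xs) (x∉ ∷ _)  (here refl) x∈ys = All.lookup x∉ (∈-++⁺ʳ xs x∈ys) refl
Unique-++⇒disjoint (_ ∷ xs) (_ ∷ uniq) (there x∈)  x∈ys = Unique-++⇒disjoint xs uniq x∈ x∈ys

_≺_ : List ℕ → List ℕ → Set
xs ≺ ys = ∀ {x y} → x ∈ xs → y ∈ ys → x < y

interval-split-[] : ∀ {n lo} (u : List ℕ) → u ++ [] ↭ interval lo n → u ↭ interval (lo + 0) (length u)
interval-split-[] {n} {lo} u p =
  subst₂ (λ l m → u ↭ interval l m) (sym (+-identityʳ lo))
         (sym (trans (↭.↭-length u↭) (length-interval lo n))) u↭
  where
  u↭ : u ↭ interval lo n
  u↭ = subst (_↭ interval lo n) (++-identityʳ u) p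

lo∈u⇒v≡[] : ∀ {n lo} (u v : List ℕ) → u ++ v ↭ interval lo n → v ≺ u → lo ∈ u → v ≡ []
lo∈u⇒v≡[] u []      _ _   _    = refl
lo∈u⇒v≡[] {n} {lo} u (c ∷ _) p v≺u lo∈u =
  ⊥-elim (<⇒≱ (v≺u (here refl) lo∈u)
              (proj₁ (∈-interval⁻ lo n (↭.∈-resp-↭ p (∈-++⁺ʳ u (here refl))))))

-- lo, the least letter, lies in v unless v is empty; remove it and recurse.
interval-split : ∀ n lo (u v : List ℕ) → u ++ v ↭ interval lo n → v ≺ u →
                 v ↭ interval lo (length v) × u ↭ interval (lo + length v) (length u)
interval-split zero lo u v p _ with refl ← ++-conicalʳ u v (↭.↭-empty-inv p) = ↭-refl , interval-split-[] u p
interval-split (suc n) lo u v p v≺u with ∈-++⁻ u (↭.∈-resp-↭ (↭-sym p) (here refl))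
... | inj₁ lo∈u with refl ← lo∈u⇒v≡[] u v p v≺u lo∈u = ↭-refl , interval-split-[] u p
... | inj₂ lo∈v with v₁ , v₂ , refl ← ∈-∃++ lo∈v = peel
  where
  p′ : u ++ v₁ ++ v₂ ↭ interval (suc lo) n
  p′ = subst (_↭ interval (suc lo) n) (++-assoc u v₁ v₂)
         (↭.drop-mid (u ++ v₁) [] (subst (_↭ interval lo (suc n)) (sym (++-assoc u v₁ (lo ∷ v₂))) p))
  widen : ∀ {c} → c ∈ v₁ ++ v₂ → c ∈ v₁ ++ lo ∷ v₂
  widen c∈ with ∈-++⁻ v₁ c∈
  ... | inj₁ c∈v₁ = ∈-++⁺ˡ c∈v₁
  ... | inj₂ c∈v₂ = ∈-++⁺ʳ v₁ (there c∈v₂)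
  ih : v₁ ++ v₂ ↭ interval (suc lo) (length (v₁ ++ v₂)) × u ↭ interval (suc lo + length (v₁ ++ v₂)) (length u)
  ih = interval-split n (suc lo) u (v₁ ++ v₂) p′ (v≺u ∘ widen)
  peel : v₁ ++ lo ∷ v₂ ↭ interval lo (length (v₁ ++ lo ∷ v₂))
       × u ↭ interval (lo + length (v₁ ++ lo ∷ v₂)) (length u)
  peel rewrite ↭.↭-length (↭.shift lo v₁ v₂) | +-suc lo (length (v₁ ++ v₂)) =
    ↭-trans (↭.shift lo v₁ v₂) (↭-prep lo (proj₁ ih)) , proj₂ ih

encodeFrom : ℕ → Tree → List ℕ
encodeFrom lo tip       = []
encodeFrom lo (bin l r) = encodeFrom (suc lo + size r) l ++ lo ∷ encodeFrom (suc lo) r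

encode : Tree → List ℕ
encode = encodeFrom 1

encodeFrom-↭ : ∀ lo x → encodeFrom lo x ↭ interval lo (size x)
encodeFrom-↭ lo tip       = ↭-refl
encodeFrom-↭ lo (bin l r) = begin
  encodeFrom (suc lo + size r) l ++ lo ∷ encodeFrom (suc lo) r
    ↭⟨ ↭.++⁺ (encodeFrom-↭ (suc lo + size r) l) (↭-prep lo (encodeFrom-↭ (suc lo) r)) ⟩
  interval (suc lo + size r) (size l) ++ interval lo (suc (size r))
    ↭⟨ ↭.++-comm (interval (suc lo + size r) (size l)) (interval lo (suc (size r))) ⟩
  interval lo (suc (size r)) ++ interval (suc lo + size r) (size l)
    ≡⟨ cong (λ k → interval lo (suc (size r)) ++ interval k (size l)) (+-suc lo (size r)) ⟨
  interval lo (suc (size r)) ++ interval (lo + suc (size r)) (size l)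
    ≡⟨ interval-++ lo (suc (size r)) (size l) ⟨
  interval lo (suc (size r + size l))
    ≡⟨ cong (interval lo ∘ suc) (+-comm (size r) (size l)) ⟩
  interval lo (size (bin l r)) ∎
  where open PermutationReasoning

length-encodeFrom : ∀ lo x → length (encodeFrom lo x) ≡ size x
length-encodeFrom lo x = trans (↭.↭-length (encodeFrom-↭ lo x)) (length-interval lo (size x))

∈-encodeFrom⁻ : ∀ {z} lo x → z ∈ encodeFrom lo x → lo ≤ z × z < lo + size x
∈-encodeFrom⁻ lo x z∈ = ∈-interval⁻ lo (size x) (↭.∈-resp-↭ (encodeFrom-↭ lo x) z∈)

takeWhile-++-∷ : ∀ {x y} (xs : List ℕ) ys → ¬ x < y → takeWhile (x <?_) (xs ++ y ∷ ys) ≡ takeWhile (x <?_) xs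
takeWhile-++-∷ {x} {y} []       ys x≮y rewrite dec-false (x <? y) x≮y = refl
takeWhile-++-∷ {x}     (z ∷ xs) ys x≮y with x <? z
... | yes x<z rewrite dec-true (x <? z) x<z = cong (z ∷_) (takeWhile-++-∷ xs ys x≮y)
... | no  x≮z rewrite dec-false (x <? z) x≮z = refl

ρlen-all : ∀ {x w} → All (x <_) w → ρlen x w ≡ length w
ρlen-all {x} x<w = cong length (all⇒takeWhile≗id (x <?_) x<w)

jacobi-++⁻ : ∀ {y} (xs : List ℕ) {ys} → All (y <_) xs → Jacobi (xs ++ y ∷ ys) → Jacobi xs × Jacobi (y ∷ ys)
jacobi-++⁻ []       []           jac        = tt , jac
jacobi-++⁻ (x ∷ xs) (y<x ∷ y<xs) (2∣ρ , jac) with jac-xs , jac-y∷ys ← jacobi-++⁻ xs y<xs jac =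
  (subst (2 ∣_) (cong length (takeWhile-++-∷ xs _ (<⇒≯ y<x))) 2∣ρ , jac-xs) , jac-y∷ys

jacobi-++⁺ : ∀ {y} (xs : List ℕ) {ys} → All (y <_) xs → Jacobi xs → Jacobi (y ∷ ys) → Jacobi (xs ++ y ∷ ys)
jacobi-++⁺ []       []           _             jac-y∷ys = jac-y∷ys
jacobi-++⁺ (x ∷ xs) (y<x ∷ y<xs) (2∣ρ , jac-xs) jac-y∷ys =
  subst (2 ∣_) (sym (cong length (takeWhile-++-∷ xs _ (<⇒≯ y<x)))) 2∣ρ , jacobi-++⁺ xs y<xs jac-xs jac-y∷ys

Avoids213-⊆ : ∀ {xs ys} → xs ⊆ ys → Avoids213 ys → Avoids213 xs
Avoids213-⊆ xs⊆ys avoids (a , b , c , abc⊆xs , b<a , a<c) = avoids (a , b , c , ⊆-trans abc⊆xs xs⊆ys , b<a , a<c)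

⊆-++⁻ : ∀ (xs : List ℕ) {ys zs} → zs ⊆ xs ++ ys →
        ∃₂ λ zs₁ zs₂ → zs ≡ zs₁ ++ zs₂ × zs₁ ⊆ xs × zs₂ ⊆ ys
⊆-++⁻ []       zs⊆ys = [] , _ , refl , [] , zs⊆ys
⊆-++⁻ (x ∷ xs) (_ Sublist.∷ʳ zs⊆) with zs₁ , zs₂ , refl , zs₁⊆ , zs₂⊆ ← ⊆-++⁻ xs zs⊆ =
  zs₁ , zs₂ , refl , x Sublist.∷ʳ zs₁⊆ , zs₂⊆
⊆-++⁻ (x ∷ xs) (refl ∷ zs⊆)       with zs₁ , zs₂ , refl , zs₁⊆ , zs₂⊆ ← ⊆-++⁻ xs zs⊆ =
  x ∷ zs₁ , zs₂ , refl , refl ∷ zs₁⊆ , zs₂⊆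

Avoids213-++ : ∀ (xs : List ℕ) {ys} → ys ≺ xs → Avoids213 xs → Avoids213 ys → Avoids213 (xs ++ ys)
Avoids213-++ xs ys≺xs avoids-xs avoids-ys (a , b , c , abc⊆ , b<a , a<c) with ⊆-++⁻ xs abc⊆
... | []              , _ , refl , _   , abc⊆ys = avoids-ys (a , b , c , abc⊆ys , b<a , a<c)
... | _ ∷ []          , _ , refl , a⊆  , bc⊆   = <-asym a<c (ys≺xs (to∈ (∷ˡ⁻ bc⊆)) (to∈ a⊆))
... | _ ∷ _ ∷ []      , _ , refl , ab⊆ , c⊆    = <-asym a<c (ys≺xs (to∈ c⊆) (to∈ ab⊆))
... | _ ∷ _ ∷ _ ∷ []  , _ , refl , abc⊆xs , _ = avoids-xs (a , b , c , abc⊆xs , b<a , a<c)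

Avoids213-∷ : ∀ {x w} → All (x <_) w → Avoids213 w → Avoids213 (x ∷ w)
Avoids213-∷ x<w avoids (a , b , c , (_ Sublist.∷ʳ abc⊆) , b<a , a<c) = avoids (a , b , c , abc⊆ , b<a , a<c)
Avoids213-∷ x<w avoids (a , b , c , (refl ∷ bc⊆) , b<a , a<c) = <-asym b<a (All.lookup x<w (to∈ bc⊆))

module _ (lo : ℕ) (l r : Tree) where

  private
    u = encodeFrom (suc lo + size r) l
    v = encodeFrom (suc lo) r

  root<left : All (lo <_) u
  root<left = All.tabulate λ a∈u →
    ≤-trans (m≤m+n (suc lo) (size r)) (proj₁ (∈-encodeFrom⁻ (suc lo + size r) l a∈u))

  root<right : All (lo <_) v
  root<right = All.tabulate λ c∈v → proj₁ (∈-encodeFrom⁻ (suc lo) r c∈v)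

  right≺left : (lo ∷ v) ≺ u
  right≺left (here refl) a∈u = All.lookup root<left a∈u
  right≺left (there c∈v) a∈u =
    <-≤-trans (proj₂ (∈-encodeFrom⁻ (suc lo) r c∈v)) (proj₁ (∈-encodeFrom⁻ (suc lo + size r) l a∈u))

encodeFrom-avoids213 : ∀ lo x → Avoids213 (encodeFrom lo x)
encodeFrom-avoids213 lo tip       (_ , _ , _ , () , _)
encodeFrom-avoids213 lo (bin l r) =
  Avoids213-++ (encodeFrom (suc lo + size r) l) (right≺left lo l r) (encodeFrom-avoids213 (suc lo + size r) l)
    (Avoids213-∷ (root<right lo l r) (encodeFrom-avoids213 (suc lo) r))

encodeFrom-jacobi : ∀ lo {x} → EvenRight x → Jacobi (encodeFrom lo x)
encodeFrom-jacobi lo tip                        = tt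
encodeFrom-jacobi lo (bin {l} {r} er-l er-r 2∣r) =
  jacobi-++⁺ (encodeFrom (suc lo + size r) l) (root<left lo l r) (encodeFrom-jacobi (suc lo + size r) er-l)
    (subst (2 ∣_) (sym ρ≡size) 2∣r , encodeFrom-jacobi (suc lo) er-r)
  where
  ρ≡size : ρlen lo (encodeFrom (suc lo) r) ≡ size r
  ρ≡size = trans (ρlen-all (root<right lo l r)) (length-encodeFrom (suc lo) r)

encodeFrom-∷ʳ : ∀ lo l r → LastIs (lo + rightSpine r) (encodeFrom lo (bin l r))
encodeFrom-∷ʳ lo l tip = encodeFrom (suc lo + 0) l , cong (encodeFrom (suc lo + 0) l ∷ʳ_) (sym (+-identityʳ lo))
encodeFrom-∷ʳ lo l (bin l′ r′) with σ , eq ← encodeFrom-∷ʳ (suc lo) l′ r′ =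
  u ++ lo ∷ σ , (begin
    u ++ lo ∷ encodeFrom (suc lo) (bin l′ r′)   ≡⟨ cong (λ w → u ++ lo ∷ w) eq ⟩
    u ++ lo ∷ σ ∷ʳ (suc lo + rightSpine r′)     ≡⟨ ++-assoc u (lo ∷ σ) _ ⟨
    (u ++ lo ∷ σ) ∷ʳ (suc lo + rightSpine r′)   ≡⟨ cong ((u ++ lo ∷ σ) ∷ʳ_) (+-suc lo (rightSpine r′)) ⟨
    (u ++ lo ∷ σ) ∷ʳ (lo + rightSpine (bin l′ r′)) ∎)
  where
  open ≡-Reasoning
  u = encodeFrom (suc lo + size (bin l′ r′)) l

LastIs-encode : ∀ {k} x → LastIs (suc k) (encode x) ⇔ rightSpine x ≡ suc k
LastIs-encode tip       = mk⇔ (λ (σ , eq) → case ++-conicalʳ σ _ (sym eq) of λ ()) (λ ())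
LastIs-encode (bin l r) = mk⇔
  (λ (σ , eq) → let σ′ , eq′ = encodeFrom-∷ʳ 1 l r in proj₂ (∷ʳ-injective σ′ σ (trans (sym eq′) eq)))
  (λ spine≡ → subst (λ k → LastIs k (encode (bin l r))) spine≡ (encodeFrom-∷ʳ 1 l r))

++-∷-cancel : ∀ {x} (u u′ : List ℕ) {v v′} → x ∉ u → x ∉ u′ → u ++ x ∷ v ≡ u′ ++ x ∷ v′ →
              u ≡ u′ × v ≡ v′
++-∷-cancel []      []        _   _    refl = refl , refl
++-∷-cancel []      (y ∷ u′)  _   x∉u′ eq   = ⊥-elim (x∉u′ (here (∷-injectiveˡ eq)))
++-∷-cancel (y ∷ u) []        x∉u _    eq   = ⊥-elim (x∉u (here (sym (∷-injectiveˡ eq))))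
++-∷-cancel (y ∷ u) (y′ ∷ u′) x∉u x∉u′ eq with refl ← ∷-injectiveˡ eq
  with refl , refl ← ++-∷-cancel u u′ (x∉u ∘ there) (x∉u′ ∘ there) (∷-injectiveʳ eq) = refl , refl

lo∉encodeFrom : ∀ lo k x → lo ∉ encodeFrom (suc lo + k) x
lo∉encodeFrom lo k x lo∈ = <⇒≱ (m≤m+n (suc lo) k) (proj₁ (∈-encodeFrom⁻ (suc lo + k) x lo∈))

encodeFrom-injective : ∀ lo {x y} → encodeFrom lo x ≡ encodeFrom lo y → x ≡ y
encodeFrom-injective lo {tip}     {tip}       _  = refl
encodeFrom-injective lo {tip}     {bin l r}   eq = case ++-conicalʳ (encodeFrom (suc lo + size r) l) _ (sym eq) of λ ()
encodeFrom-injective lo {bin l r} {tip}       eq = case ++-conicalʳ (encodeFrom (suc lo + size r) l) _ eq of λ ()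
encodeFrom-injective lo {bin l r} {bin l′ r′} eq
  with left≡ , right≡ ← ++-∷-cancel (encodeFrom (suc lo + size r) l) (encodeFrom (suc lo + size r′) l′)
                                    (lo∉encodeFrom lo (size r) l) (lo∉encodeFrom lo (size r′) l′) eq
  with refl ← encodeFrom-injective (suc lo) {r} {r′} right≡
  with refl ← encodeFrom-injective (suc lo + size r) {l} {l′} left≡ = refl

avoids213⇒right≺left : ∀ {n lo} (u v : List ℕ) → u ++ lo ∷ v ↭ interval lo (suc n) →
                       Avoids213 (u ++ lo ∷ v) → v ≺ u
avoids213⇒right≺left {n} {lo} u v p avoids {c} {a} c∈v a∈u with <-cmp c a
... | tri< c<a _ _ = c<a
... | tri≈ _ refl _ =
  ⊥-elim (Unique-++⇒disjoint u (Unique-resp-↭ (↭-sym (↭.drop-mid u [] p)) (interval-unique (suc lo) n))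
                             a∈u c∈v)
... | tri> _ _ a<c =
  ⊥-elim (avoids (a , lo , c , Sublist.++⁺ (from∈ a∈u) (refl ∷ from∈ c∈v) , lo<a , a<c))
  where
  lo<a : lo < a
  lo<a = proj₁ (∈-interval⁻ (suc lo) n (↭.∈-resp-↭ (↭.drop-mid u [] p) (∈-++⁺ˡ a∈u)))

decodeFrom : ∀ {n} → Acc _<_ n → ∀ lo π → π ↭ interval lo n → Avoids213 π → Jacobi π →
             ∃[ x ] (EvenRight x × size x ≡ n × π ≡ encodeFrom lo x)
decodeFrom {zero}  _         lo π p _ _ = tip , tip , refl , ↭.↭-empty-inv p
decodeFrom {suc n} (acc rec) lo π p avoids jac
  with u , v , refl ← ∈-∃++ (↭.∈-resp-↭ (↭-sym p) (here refl))
  with p′ ← ↭.drop-mid u [] p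
  with lo<u , lo<v ← All.++⁻ u (All.tabulate λ z∈ → proj₁ (∈-interval⁻ (suc lo) n (↭.∈-resp-↭ p′ z∈)))
  with v↭ , u↭ ← interval-split n (suc lo) u v p′ (avoids213⇒right≺left u v p avoids)
  with jac-u , 2∣ρ , jac-v ← jacobi-++⁻ u lo<u jac
  with refl ← trans (sym (length-++ u)) (trans (↭.↭-length p′) (length-interval (suc lo) n))
  with r , er , size-r , refl ←
         decodeFrom (rec (s≤s (m≤n+m (length v) (length u)))) (suc lo) v v↭
                    (Avoids213-⊆ (Sublist.++⁺ˡ u (lo Sublist.∷ʳ ⊆-refl)) avoids) jac-v
  with l , el , size-l , refl ←
         decodeFrom (rec (s≤s (m≤m+n (length u) (length v)))) (suc lo + length v) u u↭
                    (Avoids213-⊆ (Sublist.++⁺ʳ (lo ∷ v) ⊆-refl) avoids) jac-u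
  = bin l r
  , bin el er (subst (2 ∣_) (trans (ρlen-all lo<v) (sym size-r)) 2∣ρ)
  , cong suc (cong₂ _+_ size-l size-r)
  , cong (λ k → encodeFrom (suc lo + k) l ++ lo ∷ encodeFrom (suc lo) r) (length-encodeFrom (suc lo) r)

JLastTree : ℕ → ℕ → Tree → Set
JLastTree m k x = EvenRight x × size x ≡ m × rightSpine x ≡ k

JLast213⇔encode : ∀ m k π → JLast213 m (suc k) π ⇔ (∃[ x ] (JLastTree m (suc k) x × π ≡ encode x))
JLast213⇔encode m k π = mk⇔ to from
  where
  to : JLast213 m (suc k) π → ∃[ x ] (JLastTree m (suc k) x × π ≡ encode x)
  to (perm , avoids , jac , last)
    with x , er , size≡ , refl ←
           decodeFrom (<-wellFounded m) 1 π (subst (π ↭_) ([1‥]≡interval m) perm) avoids jac =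
    x , (er , size≡ , Equivalence.to (LastIs-encode x) last) , refl
  from : ∃[ x ] (JLastTree m (suc k) x × π ≡ encode x) → JLast213 m (suc k) π
  from (x , (er , refl , spine≡) , refl) =
    subst (encode x ↭_) (sym ([1‥]≡interval (size x))) (encodeFrom-↭ 1 x) ,
    encodeFrom-avoids213 1 x , encodeFrom-jacobi 1 er , Equivalence.from (LastIs-encode x) spine≡

HasCount-map : ∀ {A : Set} {P : List ℕ → Set} (f : A → List ℕ) {xs : List A} →
               (∀ {x y} → f x ≡ f y → x ≡ y) → Unique xs →
               (∀ π → P π ⇔ (∃[ x ] (x ∈ xs × π ≡ f x))) → HasCount P (length xs)
HasCount-map f {xs} f-injective xs-unique P⇔ =
  map f xs , Unique.map⁺ f-injective xs-unique ,
  (λ π → mk⇔ (λ π∈ → Equivalence.from (P⇔ π) (∈-map⁻ f π∈))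
             (λ Pπ → let x , x∈ , π≡ = Equivalence.to (P⇔ π) Pπ
                     in subst (_∈ map f xs) (sym π≡) (∈-map⁺ f x∈))) ,
  length-map f xs

JLast213-count : ∀ {r} p m k (φ : Vec Ternary r → Tree) → (∀ {F G} → φ F ≡ φ G → F ≡ G) →
                 (∀ F → forestNodes F ≡ p → JLastTree m (suc k) (φ F)) →
                 (∀ {x} → JLastTree m (suc k) x → ∃[ F ] (forestNodes F ≡ p × φ F ≡ x)) →
                 HasCount (JLast213 m (suc k)) (forestCount p r)
JLast213-count {r} p m k φ φ-injective sound complete =
  subst (HasCount (JLast213 m (suc k))) (length-forests p r)
    (HasCount-map (encode ∘ φ) (φ-injective ∘ encodeFrom-injective 1) (forests-unique p r) (λ π → mk⇔ to from))
  where
  to : ∀ {π} → JLast213 m (suc k) π → ∃[ F ] (F ∈ forests p r × π ≡ encode (φ F))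
  to {π} j with x , tree , refl ← Equivalence.to (JLast213⇔encode m k π) j
           with F , nodes≡ , refl ← complete tree = F , forests-complete p r F nodes≡ , refl
  from : ∀ {π} → ∃[ F ] (F ∈ forests p r × π ≡ encode (φ F)) → JLast213 m (suc k) π
  from (F , F∈ , refl) =
    Equivalence.from (JLast213⇔encode m k _) (φ F , sound F (All.lookup (forests-sound p r) F∈) , refl)

count-even : ∀ p k → HasCount (JLast213 (2 * (suc k + p)) (suc k)) (forestCount p (double (suc k)))
count-even p k = JLast213-count p (2 * (suc k + p)) k evenSpine evenSpine-injective sound complete
  where
  sound : ∀ F → forestNodes F ≡ p → JLastTree (2 * (suc k + p)) (suc k) (evenSpine F)
  sound F nodes≡ =
    evenRight-evenSpine F ,
    trans (size-evenSpine F) (cong (λ N → 2 * (suc k + N)) nodes≡) ,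
    rightSpine-evenSpine F
  complete : ∀ {x} → JLastTree (2 * (suc k + p)) (suc k) x → ∃[ F ] (forestNodes F ≡ p × evenSpine F ≡ x)
  complete (er , size≡ , spine≡)
    with F , refl ← evenSpine-surjective er (subst (2 ∣_) (sym size≡) (m∣m*n (suc k + p))) spine≡ =
    F , +-cancelˡ-≡ (suc k) _ _ (*-cancelˡ-≡ _ _ 2 (trans (sym (size-evenSpine F)) size≡)) , refl

-- The left-hand side reduces to n + suc (n + 0).
2*[1+n]∸1≡1+2*n : ∀ n → 2 * suc n ∸ 1 ≡ suc (2 * n)
2*[1+n]∸1≡1+2*n n = +-suc n (n + 0)

count-odd : ∀ p k → HasCount (JLast213 (2 * (suc k + p) ∸ 1) (suc k)) (forestCount p (suc (double k)))
count-odd p k = JLast213-count p (2 * (suc k + p) ∸ 1) k oddSpine oddSpine-injective sound complete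
  where
  sound : ∀ F → forestNodes F ≡ p → JLastTree (2 * (suc k + p) ∸ 1) (suc k) (oddSpine F)
  sound F nodes≡ =
    evenRight-oddSpine F ,
    trans (size-oddSpine F) (trans (cong (λ N → suc (2 * (k + N))) nodes≡) (sym (2*[1+n]∸1≡1+2*n (k + p)))) ,
    rightSpine-oddSpine F
  complete : ∀ {x} → JLastTree (2 * (suc k + p) ∸ 1) (suc k) x → ∃[ F ] (forestNodes F ≡ p × oddSpine F ≡ x)
  complete (er , size≡ , spine≡)
    with F , refl ← oddSpine-surjective er
                      (subst (λ s → 2 ∣ suc s) (sym (trans size≡ (2*[1+n]∸1≡1+2*n (k + p))))
                             (∣m∣n⇒∣m+n ∣-refl (m∣m*n (k + p))))
                      spine≡ =
    F , +-cancelˡ-≡ k _ _ (*-cancelˡ-≡ _ _ 2 (suc-injective (trans (sym (size-oddSpine F))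
                                                        (trans size≡ (2*[1+n]∸1≡1+2*n (k + p)))))) , refl

double≡2* : ∀ k → double k ≡ 2 * k
double≡2* zero    = refl
double≡2* (suc k) = trans (cong (2 +_) (double≡2* k)) (arith k)
  where
  arith : ∀ k → 2 + 2 * k ≡ 2 * suc k
  arith = solve-∀

2*[k+p]≡2*p+double-k : ∀ k p → 2 * (k + p) ≡ 2 * p + double k
2*[k+p]≡2*p+double-k k p = trans (arith k p) (cong (2 * p +_) (sym (double≡2* k)))
  where
  arith : ∀ k p → 2 * (k + p) ≡ 2 * p + 2 * k
  arith = solve-∀

3*[k+p]∸k≡3*p+double-k : ∀ k p → 3 * (k + p) ∸ k ≡ 3 * p + double k
3*[k+p]∸k≡3*p+double-k k p =
  trans (cong (_∸ k) (trans (arith k p) (cong (λ d → 3 * p + d + k) (sym (double≡2* k))))) (m+n∸n≡m _ k)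
  where
  arith : ∀ k p → 3 * (k + p) ≡ 3 * p + 2 * k + k
  arith = solve-∀

m+[1+n]∸1≡m+n : ∀ m n → m + suc n ∸ 1 ≡ m + n
m+[1+n]∸1≡m+n m n = cong (_∸ 1) (+-suc m n)

closed-form-at : ∀ p r {a b c} → a ≡ 3 * p + r → b ≡ r → c ≡ 2 * p + r → a * forestCount p r ≡ b * (a C c)
closed-form-at p r refl refl refl = forestCount-closed p r

even-closed-form : ∀ p k → (3 * (suc k + p) ∸ suc k) * forestCount p (double (suc k))
                           ≡ (2 * suc k) * ((3 * (suc k + p) ∸ suc k) C (2 * (suc k + p)))
even-closed-form p k = closed-form-at p (double (suc k))
  (3*[k+p]∸k≡3*p+double-k (suc k) p) (sym (double≡2* (suc k))) (2*[k+p]≡2*p+double-k (suc k) p)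

odd-closed-form : ∀ p k → (3 * (suc k + p) ∸ suc k ∸ 1) * forestCount p (suc (double k))
                          ≡ (2 * suc k ∸ 1) * ((3 * (suc k + p) ∸ suc k ∸ 1) C (2 * (suc k + p) ∸ 1))
odd-closed-form p k = closed-form-at p (suc (double k))
  (trans (cong (_∸ 1) (3*[k+p]∸k≡3*p+double-k (suc k) p)) (m+[1+n]∸1≡m+n (3 * p) (suc (double k))))
  (trans (2*[1+n]∸1≡1+2*n k) (cong suc (sym (double≡2* k))))
  (trans (cong (_∸ 1) (2*[k+p]≡2*p+double-k (suc k) p)) (m+[1+n]∸1≡m+n (2 * p) (suc (double k))))

theorem4p7 : (n k : ℕ) → 1 ≤ k → k ≤ n →
    (∃[ N ] (HasCount (JLast213 (2 * n) k) N × (3 * n ∸ k) * N ≡ (2 * k) * ((3 * n ∸ k) C (2 * n))))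
    × (∃[ N ] (HasCount (JLast213 (2 * n ∸ 1) k) N × (3 * n ∸ k ∸ 1) * N ≡ (2 * k ∸ 1) * ((3 * n ∸ k ∸ 1) C (2 * n ∸ 1))))
theorem4p7 n (suc k) _ k≤n with p , refl ← m≤n⇒∃[o]m+o≡n k≤n =
  (forestCount p (double (suc k)) , count-even p k , even-closed-form p k) ,
  (forestCount p (suc (double k)) , count-odd p k , odd-closed-form p k)
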